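{- $\kappa^s(Q_5;K_{1,4})\ge 3$.
   Context: The $n$-dimensional hypercube $Q_n$ has as vertices all binary strings of length $n$, two strings being adjacent iff they differ in exactly one position. $K_{1,r}$ denotes the star with $r$ leaves. For a graph $G$ and a set $F$ of subgraphs of $G$, $G-F$ denotes the graph obtained from $G$ by deleting all vertices of all members of $F$. For a connected graph $T$, $\kappa^s(G;T)$ is the minimum cardinality of a set $F$ of subgraphs of $G$, each isomorphic to a connected subgraph of $T$, such that $G-F$ is disconnected. -}

module Defs where

open import Data.Nat using (ℕ; zero; suc; _≤_)
open import Data.Bool using (Bool)
open import Data.Fin using (Fin)
open import Data.Vec using (Vec; []; _∷_)
open import Data.List using (List)
open import Data.List.Relation.Unary.Any using (Any)
open import Data.Product using (Σ; _×_; ∃; ∃-syntax)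
open import Data.Sum using (_⊎_)
open import Relation.Binary.PropositionalEquality using (_≡_; _≢_)
open import Relation.Nullary using (¬_)
open import Function.Definitions using (Injective)

Vertex : ℕ → Set
Vertex n = Vec Bool n

hamming : ∀ {n} → Vertex n → Vertex n → ℕ
hamming [] [] = 0
hamming (x ∷ xs) (y ∷ ys) with Data.Bool._≟_ x y
... | Relation.Nullary.yes _ = hamming xs ys
... | Relation.Nullary.no  _ = suc (hamming xs ys)

Adj : ∀ {n} → Vertex n → Vertex n → Set
Adj u v = hamming u v ≡ 1

-- A subgraph of Q_n isomorphic to the star K_{1,r}: a centre and r
-- pairwise distinct leaves, each adjacent to the centre.  (K_{1,0} = K_1.)
record Star (n r : ℕ) : Set where
  field
    center   : Vertex n
    leaf     : Fin r → Vertex n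
    leafInj  : Injective _≡_ _≡_ leaf
    leafAdj  : ∀ i → Adj center (leaf i)

-- A subgraph of Q_n isomorphic to a connected subgraph of K_{1,4}.
-- The connected subgraphs of K_{1,4} are, up to isomorphism, exactly
-- K_{1,r} for 0 ≤ r ≤ 4.
record StarSub (n : ℕ) : Set where
  field
    r      : ℕ
    r≤4    : r ≤ 4
    star   : Star n r

_∈S_ : ∀ {n} → Vertex n → StarSub n → Set
v ∈S S = v ≡ Star.center (StarSub.star S) ⊎ ∃[ i ] Star.leaf (StarSub.star S) i ≡ v

Deleted : ∀ {n} → List (StarSub n) → Vertex n → Set
Deleted F v = Any (v ∈S_) F

data Walk {n : ℕ} (F : List (StarSub n)) : Vertex n → Vertex n → Set where
  here  : ∀ {u} → ¬ Deleted F u → Walk F u u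
  step  : ∀ {u v w} → ¬ Deleted F u → Adj u v → Walk F v w → Walk F u w

Disconnected : ∀ {n} → List (StarSub n) → Set
Disconnected F = ∃[ u ] ∃[ v ] (¬ Deleted F u × ¬ Deleted F v × ¬ Walk F u v)

module Submission where

-- A connected subgraph of K_{1,4} in Q_5 is a star with centre c and at most four of
-- the five neighbours of c, so its vertices lie in N[c] minus the neighbour of c across
-- some direction d.  If |F| ≤ 2, the deleted vertices thus lie in the union B of at most
-- two such sets, and both centres are deleted.  Translating the first centre to 0 (an
-- automorphism of Q_5) leaves 32 · 5 · 5 possible sets B, which are checked by
-- evaluation: a breadth-first search shows that the vertices outside B induce a
-- connected subgraph, and every vertex of B other than the two centres has a neighbour
-- outside B.

open import Defs
open import Data.Nat using (_≤_)
open import Data.List using (List; length)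

open import Data.Bool as Bool using (Bool; true; false; not; _∧_; _∨_; _xor_; T; if_then_else_)
open import Data.Bool.Properties
  using (not-involutive; not-¬; ¬-not; not-distribˡ-xor; xor-assoc; xor-same; xor-identityˡ;
         xor-identityʳ; T-∧; T-∨; T-≡)
open import Data.Fin as Fin using (Fin; zero; suc)
open import Data.Fin.Properties using (pigeonhole; any?; ¬∀⟶∃¬; <⇒≢)
open import Data.List using ([]; _∷_; allFin)
open import Data.Bool.ListAction using (any; all)
open import Data.List.Membership.Propositional using (lose)
open import Data.List.Membership.Propositional.Properties using (∈-allFin)
open import Data.List.Relation.Unary.All as All using (All; []; _∷_)
open import Data.List.Relation.Unary.All.Properties using (all⁺)
open import Data.List.Relation.Unary.Any as Any using (here; there)
open import Data.List.Relation.Unary.Any.Properties using (any⁺; any⁻)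
open import Data.Nat using (ℕ; zero; suc; _<_; s≤s)
open import Data.Nat.GeneralisedArithmetic using (iterate)
open import Data.Nat.Properties using (suc-injective; 0≢1+n; ≤-refl; ≤-trans; ≰⇒>)
open import Data.Product as Product using (∃; _×_; _,_; proj₁; proj₂)
open import Data.Sum as Sum using (_⊎_; inj₁; inj₂)
open import Data.Vec using ([]; _∷_; zipWith; replicate; lookup; _[_]%=_)
open import Data.Vec.Properties
  using (≡-dec; zipWith-assoc; zipWith-identityˡ; zipWith-identityʳ;
         updateAt-updateAt-local; updateAt-id; lookup∘updateAt; lookup∘updateAt′)
open import Function using (_∘_; Injective; Equivalence)
open import Relation.Binary.PropositionalEquality
  using (_≡_; _≢_; refl; sym; trans; cong; cong₂; subst; ≢-sym; module ≡-Reasoning)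
open import Relation.Nullary using (¬_; yes; no; contradiction)
open import Relation.Nullary.Decidable using (⌊_⌋; T?; toWitness; fromWitness; fromWitnessFalse)
open import Relation.Unary using (Decidable)

open Equivalence using (to; from)

private
  variable
    n : ℕ

infixl 6 _⊕_

_⊕_ : Vertex n → Vertex n → Vertex n
_⊕_ = zipWith _xor_

0ᵛ : Vertex n
0ᵛ = replicate _ false

flipBit : Vertex n → Fin n → Vertex n
flipBit v d = v [ d ]%= not

hamming-refl : (u : Vertex n) → hamming u u ≡ 0
hamming-refl []      = refl
hamming-refl (x ∷ u) with x Bool.≟ x
... | yes _   = hamming-refl u
... | no x≢x  = contradiction refl x≢x

hamming≡0⇒≡ : (u v : Vertex n) → hamming u v ≡ 0 → u ≡ v
hamming≡0⇒≡ []      []      _ = refl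
hamming≡0⇒≡ (x ∷ u) (y ∷ v) h with x Bool.≟ y
... | yes refl = cong (x ∷_) (hamming≡0⇒≡ u v h)
... | no _     = contradiction (sym h) 0≢1+n

Adj-flipBit : (u : Vertex n) (d : Fin n) → Adj u (flipBit u d)
Adj-flipBit (x ∷ u) zero with x Bool.≟ not x
... | yes x≡¬x = contradiction x≡¬x (not-¬ refl)
... | no _     = cong suc (hamming-refl u)
Adj-flipBit (x ∷ u) (suc d) with x Bool.≟ x
... | yes _   = Adj-flipBit u d
... | no x≢x  = contradiction refl x≢x

Adj⇒flipBit : (u v : Vertex n) → Adj u v → ∃ λ d → v ≡ flipBit u d
Adj⇒flipBit []      []      ()
Adj⇒flipBit (x ∷ u) (y ∷ v) h with x Bool.≟ y
... | yes refl = Product.map suc (cong (x ∷_)) (Adj⇒flipBit u v h)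
... | no x≢y   = zero , cong₂ _∷_ (¬-not (≢-sym x≢y)) (sym (hamming≡0⇒≡ u v (suc-injective h)))

flipBit-involutive : (u : Vertex n) (d : Fin n) → flipBit (flipBit u d) d ≡ u
flipBit-involutive u d = trans (updateAt-updateAt-local d u (not-involutive _)) (updateAt-id d u)

flipBit-injective : (u : Vertex n) → Injective _≡_ _≡_ (flipBit u)
flipBit-injective u {d} {e} eq with d Fin.≟ e
... | yes d≡e = d≡e
... | no  d≢e = contradiction (sym ¬ud≡ud) (not-¬ refl)
  where
  open ≡-Reasoning
  ¬ud≡ud : not (lookup u d) ≡ lookup u d
  ¬ud≡ud = begin
    not (lookup u d)          ≡⟨ lookup∘updateAt d u ⟨
    lookup (flipBit u d) d    ≡⟨ cong (λ w → lookup w d) eq ⟩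
    lookup (flipBit u e) d    ≡⟨ lookup∘updateAt′ d e d≢e u ⟩
    lookup u d                ∎

Adj-sym : (u v : Vertex n) → Adj u v → Adj v u
Adj-sym u v adj with Adj⇒flipBit u v adj
... | d , refl = subst (Adj (flipBit u d)) (flipBit-involutive u d) (Adj-flipBit (flipBit u d) d)

flipBit-⊕ : (u a : Vertex n) (d : Fin n) → flipBit u d ⊕ a ≡ flipBit (u ⊕ a) d
flipBit-⊕ (x ∷ u) (y ∷ a) zero    = cong (_∷ (u ⊕ a)) (sym (not-distribˡ-xor x y))
flipBit-⊕ (x ∷ u) (y ∷ a) (suc d) = cong ((x xor y) ∷_) (flipBit-⊕ u a d)

⊕-self : (a : Vertex n) → a ⊕ a ≡ 0ᵛ
⊕-self []      = refl
⊕-self (x ∷ a) = cong₂ _∷_ (xor-same x) (⊕-self a)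

⊕-identityˡ : (a : Vertex n) → 0ᵛ ⊕ a ≡ a
⊕-identityˡ = zipWith-identityˡ xor-identityˡ

⊕-involutive : (u a : Vertex n) → u ⊕ a ⊕ a ≡ u
⊕-involutive u a = begin
  u ⊕ a ⊕ a    ≡⟨ zipWith-assoc xor-assoc u a a ⟩
  u ⊕ (a ⊕ a)  ≡⟨ cong (u ⊕_) (⊕-self a) ⟩
  u ⊕ 0ᵛ       ≡⟨ zipWith-identityʳ xor-identityʳ u ⟩
  u            ∎
  where open ≡-Reasoning

Connected : List (StarSub n) → Set
Connected F = ∀ {u v} → ¬ Deleted F u → ¬ Deleted F v → Walk F u v

disconnected⇒¬connected : {F : List (StarSub n)} → Disconnected F → ¬ Connected F
disconnected⇒¬connected (_ , _ , u∉ , v∉ , ¬walk) connected = ¬walk (connected u∉ v∉)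

module _ {F : List (StarSub n)} where

  snocʷ : ∀ {u v w} → Walk F u v → ¬ Deleted F w → Adj v w → Walk F u w
  snocʷ (here u∉)       w∉ adj = step u∉ adj (here w∉)
  snocʷ (step u∉ a walk) w∉ adj = step u∉ a (snocʷ walk w∉ adj)

  reverseʷ : ∀ {u v} → Walk F u v → Walk F v u
  reverseʷ (here u∉)                = here u∉
  reverseʷ (step {u} {v} u∉ a walk) = snocʷ (reverseʷ walk) u∉ (Adj-sym u v a)

  _++ʷ_ : ∀ {u v w} → Walk F u v → Walk F v w → Walk F u w
  here _         ++ʷ walk′ = walk′
  step u∉ a walk ++ʷ walk′ = step u∉ a (walk ++ʷ walk′)

  connected-via : ∀ r → (∀ u → ¬ Deleted F u → Walk F u r) → Connected F
  connected-via r toRoot u∉ v∉ = toRoot _ u∉ ++ʷ reverseʷ (toRoot _ v∉)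

missingDirection : ∀ {r} → r < n → (S : Star n r) →
                   ∃ λ d → ∀ i → Star.leaf S i ≢ flipBit (Star.center S) d
missingDirection {n} r<n S = Product.map₂ (λ ¬hit i eq → ¬hit (i , eq)) (¬∀⟶∃¬ n Hit hit? ¬allHit)
  where
  open Star S
  Hit : Fin n → Set
  Hit d = ∃ λ i → leaf i ≡ flipBit center d
  hit? : Decidable Hit
  hit? d = any? λ i → ≡-dec Bool._≟_ (leaf i) (flipBit center d)
  ¬allHit : ¬ (∀ d → Hit d)
  ¬allHit allHit with pigeonhole r<n (proj₁ ∘ allHit)
  ... | d , e , d<e , sameLeaf = <⇒≢ d<e (flipBit-injective center (begin
    flipBit center d            ≡⟨ proj₂ (allHit d) ⟨
    leaf (proj₁ (allHit d))     ≡⟨ cong leaf sameLeaf ⟩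
    leaf (proj₁ (allHit e))     ≡⟨ proj₂ (allHit e) ⟩
    flipBit center e            ∎))
    where open ≡-Reasoning

-- A Boolean function on the vertices of Q_n, memoised as a complete binary tree.
Table : ℕ → Set
Table zero    = Bool
Table (suc n) = Table n × Table n

lookupᵗ : Table n → Vertex n → Bool
lookupᵗ b       []          = b
lookupᵗ (t , _) (true  ∷ v) = lookupᵗ t v
lookupᵗ (_ , f) (false ∷ v) = lookupᵗ f v

tabulateᵗ : (Vertex n → Bool) → Table n
tabulateᵗ {zero}  p = p []
tabulateᵗ {suc n} p = tabulateᵗ (p ∘ (true ∷_)) , tabulateᵗ (p ∘ (false ∷_))

lookup∘tabulateᵗ : (p : Vertex n → Bool) (v : Vertex n) → lookupᵗ (tabulateᵗ p) v ≡ p v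
lookup∘tabulateᵗ p []          = refl
lookup∘tabulateᵗ p (true  ∷ v) = lookup∘tabulateᵗ (p ∘ (true ∷_)) v
lookup∘tabulateᵗ p (false ∷ v) = lookup∘tabulateᵗ (p ∘ (false ∷_)) v

allVertices : (Vertex n → Bool) → Bool
allVertices {zero}  p = p []
allVertices {suc n} p = allVertices (p ∘ (true ∷_)) ∧ allVertices (p ∘ (false ∷_))

allVertices-sound : (p : Vertex n → Bool) → T (allVertices p) → ∀ v → T (p v)
allVertices-sound p all-p []          = all-p
allVertices-sound p all-p (true  ∷ v) = allVertices-sound (p ∘ (true ∷_)) (proj₁ (to T-∧ all-p)) v
allVertices-sound p all-p (false ∷ v) = allVertices-sound (p ∘ (false ∷_)) (proj₂ (to T-∧ all-p)) v

allDirections : (Fin n → Bool) → Bool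
allDirections {n} p = all p (allFin n)

allDirections-sound : (p : Fin n → Bool) → T (allDirections p) → ∀ d → T (p d)
allDirections-sound {n} p all-p d = All.lookup (all⁺ p (allFin n) all-p) (∈-allFin d)

anyDirection : (Fin n → Bool) → Bool
anyDirection {n} p = any p (allFin n)

anyDirection-sound : (p : Fin n → Bool) → T (anyDirection p) → ∃ λ d → T (p d)
anyDirection-sound {n} p any-p = Any.satisfied (any⁻ p (allFin n) any-p)

anyDirection-complete : (p : Fin n → Bool) (d : Fin n) → T (p d) → T (anyDirection p)
anyDirection-complete p d pd = any⁺ p (lose (∈-allFin d) pd)

T-not⇒¬T : ∀ {b} → T (not b) → ¬ T b
T-not⇒¬T {false} _ ()

infix 4 _==_

_==_ : Vertex n → Vertex n → Bool
u == v = ⌊ ≡-dec Bool._≟_ u v ⌋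

starWithout : Vertex n → Fin n → Vertex n → Bool
starWithout c d v = (v == c) ∨ anyDirection (λ e → not ⌊ e Fin.≟ d ⌋ ∧ (v == flipBit c e))

starWithout-center : (c : Vertex n) (d : Fin n) → T (starWithout c d c)
starWithout-center c d = from (T-∨ {c == c}) (inj₁ (fromWitness refl))

starWithout-neighbour : (c : Vertex n) {d e : Fin n} → e ≢ d → T (starWithout c d (flipBit c e))
starWithout-neighbour c {d} {e} e≢d = from (T-∨ {flipBit c e == c}) (inj₂
  (anyDirection-complete (λ e′ → not ⌊ e′ Fin.≟ d ⌋ ∧ (flipBit c e == flipBit c e′)) e
    (from (T-∧ {not ⌊ e Fin.≟ d ⌋}) (fromWitnessFalse e≢d , fromWitness refl))))

starSub⊆starWithout : 5 ≤ n → (S : StarSub n) (a : Vertex n) →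
  ∃ λ d → ∀ x → x ∈S S → T (starWithout (Star.center (StarSub.star S) ⊕ a) d (x ⊕ a))
starSub⊆starWithout 5≤n S a = d , covers
  where
  open StarSub S using (r≤4; star)
  open Star star
  missing = missingDirection (≤-trans (s≤s r≤4) 5≤n) star
  d = proj₁ missing
  covers : ∀ x → x ∈S S → T (starWithout (center ⊕ a) d (x ⊕ a))
  covers x (inj₁ refl)       = starWithout-center (center ⊕ a) d
  covers x (inj₂ (i , refl)) with Adj⇒flipBit center (leaf i) (leafAdj i)
  ... | e , leaf≡ = subst (T ∘ starWithout (center ⊕ a) d)
    (sym (trans (cong (_⊕ a) leaf≡) (flipBit-⊕ center a e)))
    (starWithout-neighbour (center ⊕ a) λ e≡d →
      proj₂ missing i (trans leaf≡ (cong (flipBit center) e≡d)))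

-- Soundness of the search does not depend on the root; this one is unblocked
-- whenever some vertex is.
someUnblocked : Table n → Vertex n
someUnblocked {zero}  _       = []
someUnblocked {suc n} (t , f) =
  if allVertices (lookupᵗ t) then false ∷ someUnblocked f else true ∷ someUnblocked t

module _ (blocked : Table n) where

  bfsStep : Table n → Table n
  bfsStep R = tabulateᵗ λ v →
    lookupᵗ R v ∨ (not (lookupᵗ blocked v) ∧ anyDirection λ d → lookupᵗ R (flipBit v d))

  reached : ℕ → Vertex n → Table n
  reached k r = iterate bfsStep (tabulateᵗ λ v → not (lookupᵗ blocked v) ∧ (v == r)) k

  certified : ℕ → List (Vertex n) → Bool
  certified k exceptions =
    allVertices (λ v → lookupᵗ blocked v ∨ lookupᵗ (reached k (someUnblocked blocked)) v) ∧
    allVertices (λ v → not (lookupᵗ blocked v) ∨ (any (v ==_) exceptions ∨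
                       anyDirection λ d → not (lookupᵗ blocked (flipBit v d))))

module _ {F : List (StarSub n)} (a : Vertex n) (blocked : Table n)
         (blocked-covers : ∀ x → Deleted F x → T (lookupᵗ blocked (x ⊕ a))) where

  private
    Blocked : Vertex n → Set
    Blocked v = T (lookupᵗ blocked v)

  _⇝_ : Vertex n → Vertex n → Set
  u ⇝ v = Walk F (u ⊕ a) (v ⊕ a)

  unblocked-survives : ∀ v → ¬ Blocked v → ¬ Deleted F (v ⊕ a)
  unblocked-survives v ¬b v⊕a∈F =
    ¬b (subst Blocked (⊕-involutive v a) (blocked-covers (v ⊕ a) v⊕a∈F))

  stepFlip : ∀ {v w} d → ¬ Deleted F (v ⊕ a) → flipBit v d ⇝ w → v ⇝ w
  stepFlip {v} d v∉F =
    step v∉F (subst (Adj (v ⊕ a)) (sym (flipBit-⊕ v a d)) (Adj-flipBit (v ⊕ a) d))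

  module _ (r : Vertex n) where

    AllReach : Table n → Set
    AllReach R = ∀ v → T (lookupᵗ R v) → v ⇝ r

    seed-reaches : AllReach (tabulateᵗ λ v → not (lookupᵗ blocked v) ∧ (v == r))
    seed-reaches v t with to T-∧ (subst T (lookup∘tabulateᵗ _ v) t)
    ... | ¬b , v≡r = subst (v ⇝_) (toWitness v≡r) (here (unblocked-survives v (T-not⇒¬T ¬b)))

    bfsStep-reaches : ∀ {R} → AllReach R → AllReach (bfsStep blocked R)
    bfsStep-reaches {R} R⇝r v t with to T-∨ (subst T (lookup∘tabulateᵗ _ v) t)
    ... | inj₁ v∈R = R⇝r v v∈R
    ... | inj₂ t′ with to T-∧ t′
    ...   | ¬b , nbr∈R with anyDirection-sound _ nbr∈R
    ...     | d , flip∈R =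
      stepFlip d (unblocked-survives v (T-not⇒¬T ¬b)) (R⇝r (flipBit v d) flip∈R)

    iterate-reaches : ∀ k {R} → AllReach R → AllReach (iterate (bfsStep blocked) R k)
    iterate-reaches zero    R⇝r = R⇝r
    iterate-reaches (suc k) R⇝r = iterate-reaches k (bfsStep-reaches R⇝r)

  certified⇒connected : ∀ k exceptions → All (λ c → Deleted F (c ⊕ a)) exceptions →
                         T (certified blocked k exceptions) → Connected F
  certified⇒connected k cs cs∈F cert = connected-via (r ⊕ a) λ u u∉F →
    subst (λ w → Walk F w (r ⊕ a)) (⊕-involutive u a)
      (toRoot (u ⊕ a) (subst (¬_ ∘ Deleted F) (sym (⊕-involutive u a)) u∉F))
    where
    r = someUnblocked blocked
    covered = allVertices-sound _ (proj₁ (to T-∧ cert))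
    escapes = allVertices-sound _ (proj₂ (to T-∧ cert))

    unblocked⇝r : ∀ v → ¬ Blocked v → v ⇝ r
    unblocked⇝r v ¬b with to T-∨ (covered v)
    ... | inj₁ b         = contradiction b ¬b
    ... | inj₂ v-reached = iterate-reaches r k (seed-reaches r) v v-reached

    toRoot : ∀ v → ¬ Deleted F (v ⊕ a) → v ⇝ r
    toRoot v v∉F with T? (lookupᵗ blocked v)
    ... | no ¬b = unblocked⇝r v ¬b
    ... | yes b with to T-∨ (escapes v)
    ...   | inj₁ ¬b = contradiction b (T-not⇒¬T ¬b)
    ...   | inj₂ t with to T-∨ t
    ...     | inj₁ exceptional =
      contradiction (All.lookup cs∈F (Any.map toWitness (any⁻ _ cs exceptional))) v∉F
    ...     | inj₂ nbr-free with anyDirection-sound _ nbr-free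
    ...       | d , ¬bd = stepFlip d v∉F (unblocked⇝r (flipBit v d) (T-not⇒¬T ¬bd))

centerOf : StarSub n → Vertex n
centerOf S = Star.center (StarSub.star S)

twoStars : Vertex n → Fin n → Vertex n → Fin n → Table n
twoStars c₁ d₁ c₂ d₂ = tabulateᵗ λ v → starWithout c₁ d₁ v ∨ starWithout c₂ d₂ v

twoStars-covers : (c₁ : Vertex n) (d₁ : Fin n) (c₂ : Vertex n) (d₂ : Fin n) (v : Vertex n) →
  T (starWithout c₁ d₁ v) ⊎ T (starWithout c₂ d₂ v) → T (lookupᵗ (twoStars c₁ d₁ c₂ d₂) v)
twoStars-covers c₁ d₁ c₂ d₂ v v∈ =
  subst T (sym (lookup∘tabulateᵗ (λ w → starWithout c₁ d₁ w ∨ starWithout c₂ d₂ w) v)) (from T-∨ v∈)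

-- Opaque because unfolding this check on symbolic arguments makes type checking
-- infeasible; it is only ever evaluated on closed arguments, in allTwoStarsChecksPass.
opaque
  twoStarsCheck : Vertex 5 → Fin 5 → Fin 5 → Bool
  twoStarsCheck c d₁ d₂ = certified (twoStars 0ᵛ d₁ c d₂) 8 (0ᵛ ∷ c ∷ [])

  twoStarsCheck-sound : (c : Vertex 5) (d₁ d₂ : Fin 5) → T (twoStarsCheck c d₁ d₂) →
                        T (certified (twoStars 0ᵛ d₁ c d₂) 8 (0ᵛ ∷ c ∷ []))
  twoStarsCheck-sound _ _ _ passes = passes

  allTwoStarsChecksPass :
    allVertices (λ c → allDirections λ d₁ → allDirections (twoStarsCheck c d₁)) ≡ true
  allTwoStarsChecksPass = refl

twoStarsCertified : (c : Vertex 5) (d₁ d₂ : Fin 5) → T (certified (twoStars 0ᵛ d₁ c d₂) 8 (0ᵛ ∷ c ∷ []))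
twoStarsCertified c d₁ d₂ = twoStarsCheck-sound c d₁ d₂
  (allDirections-sound (twoStarsCheck c d₁)
    (allDirections-sound (λ d₁ → allDirections (twoStarsCheck c d₁))
      (allVertices-sound (λ c → allDirections λ d₁ → allDirections (twoStarsCheck c d₁))
        (from T-≡ allTwoStarsChecksPass) c) d₁) d₂)

coveredByTwoStars⇒connected : {F : List (StarSub 5)} (S₁ S₂ : StarSub 5) →
  (∀ x → Deleted F x → x ∈S S₁ ⊎ x ∈S S₂) →
  Deleted F (centerOf S₁) → Deleted F (centerOf S₂) → Connected F
coveredByTwoStars⇒connected {F} S₁ S₂ covered c₁∈F c₂∈F =
  certified⇒connected a (twoStars 0ᵛ d₁ c d₂) covers 8 (0ᵛ ∷ c ∷ []) exceptions
    (twoStarsCertified c d₁ d₂)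
  where
  a = centerOf S₁
  c = centerOf S₂ ⊕ a
  S₁⊆ = starSub⊆starWithout ≤-refl S₁ a
  S₂⊆ = starSub⊆starWithout ≤-refl S₂ a
  d₁ = proj₁ S₁⊆
  d₂ = proj₁ S₂⊆
  covers : ∀ x → Deleted F x → T (lookupᵗ (twoStars 0ᵛ d₁ c d₂) (x ⊕ a))
  covers x x∈F = twoStars-covers 0ᵛ d₁ c d₂ (x ⊕ a)
    (Sum.map (subst (λ z → T (starWithout z d₁ (x ⊕ a))) (⊕-self a) ∘ proj₂ S₁⊆ x) (proj₂ S₂⊆ x)
             (covered x x∈F))
  exceptions : All (λ v → Deleted F (v ⊕ a)) (0ᵛ ∷ c ∷ [])
  exceptions = subst (Deleted F) (sym (⊕-identityˡ a)) c₁∈F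
             ∷ subst (Deleted F) (sym (⊕-involutive (centerOf S₂) a)) c₂∈F ∷ []

Q₅-connected : Connected {5} []
Q₅-connected = certified⇒connected 0ᵛ (tabulateᵗ λ _ → false) (λ _ ()) 8 [] [] _

atMostTwoStars⇒connected : (F : List (StarSub 5)) → length F ≤ 2 → Connected F
atMostTwoStars⇒connected []              _ = Q₅-connected
atMostTwoStars⇒connected (S ∷ [])        _ =
  coveredByTwoStars⇒connected S S deleted⊆S (here (inj₁ refl)) (here (inj₁ refl))
  where
  deleted⊆S : ∀ x → Deleted (S ∷ []) x → x ∈S S ⊎ x ∈S S
  deleted⊆S _ (here x∈S) = inj₁ x∈S
atMostTwoStars⇒connected (S₁ ∷ S₂ ∷ [])  _ =
  coveredByTwoStars⇒connected S₁ S₂ deleted⊆S₁∪S₂ (here (inj₁ refl)) (there (here (inj₁ refl)))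
  where
  deleted⊆S₁∪S₂ : ∀ x → Deleted (S₁ ∷ S₂ ∷ []) x → x ∈S S₁ ⊎ x ∈S S₂
  deleted⊆S₁∪S₂ _ (here x∈S₁)         = inj₁ x∈S₁
  deleted⊆S₁∪S₂ _ (there (here x∈S₂)) = inj₂ x∈S₂
atMostTwoStars⇒connected (_ ∷ _ ∷ _ ∷ _) (s≤s (s≤s ()))

lemma4p2 : (F : List (StarSub 5)) → Disconnected F → 3 ≤ length F
lemma4p2 F disconnected = ≰⇒> λ length≤2 →
  disconnected⇒¬connected disconnected (atMostTwoStars⇒connected F length≤2)
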